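{- Let $q$ be a prime power, $0<k<n$ and $0\le t\le k$ integers. Let $C,C'\in\mathcal{C}_t(n,k)\setminus\mathcal{I}_t(n,k)$ and let $D,D'$ be $[n,k-1]$-linear subcodes of $C$ and $C'$ respectively, with $D,D'$ lying in the same connected component of $\Delta_t(n,k-1)$. Then $C$ and $C'$ lie in the same connected component of $\Lambda_t(n,k)$.
   Context: Let $V=\mathbb{F}_q^n$. An $[n,m]$-linear code is an $m$-dimensional subspace of $V$; $\mathcal{C}_t(n,m)$ denotes the set of $[n,m]$-codes such that any $t$ columns of a generator matrix (an $m\times n$ matrix whose rows form a basis) are linearly independent. $\Delta_t(n,m)$ is the graph on $\mathcal{C}_t(n,m)$ with $X\sim Y$ iff $\dim(X\cap Y)=m-1$. $\Lambda_t(n,k)$ is the graph on $\mathcal{C}_t(n,k)$ with $X\sim Y$ iff $X\cap Y\in\mathcal{C}_t(n,k-1)$. A code $C\in\mathcal{C}_t(n,k)$ is isolated if it contains no subspace in $\mathcal{C}_t(n,k-1)$; $\mathcal{I}_t(n,k)$ is the set of isolated codes. -}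

module Defs where

open import Level using (Level; _⊔_; suc)
open import Algebra.Bundles using (CommutativeRing)
open import Data.Nat using (ℕ; _∸_)
open import Data.Fin using (Fin; zero; suc)
import Data.Fin as Fin
open import Data.Vec using (Vec; lookup)
open import Data.Product using (Σ; ∃; _×_; _,_)
import Data.Product
open import Data.Sum using (_⊎_)
open import Relation.Nullary using (¬_; Dec)
open import Relation.Binary.PropositionalEquality using (_≡_)
open import Relation.Binary.Construct.Closure.ReflexiveTransitive using (Star)

-- A finite field with exactly q elements (q is then necessarily a prime power).
record FiniteField (c ℓ : Level) (q : ℕ) : Set (Level.suc (c ⊔ ℓ)) where
  field
    commRing : CommutativeRing c ℓ
  open CommutativeRing commRing public
  field
    _≟_      : (x y : Carrier) → Dec (x ≈ y)
    0≉1      : ¬ (0# ≈ 1#)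
    inverse  : (x : Carrier) → ¬ (x ≈ 0#) → Σ Carrier (λ y → (x * y) ≈ 1#)
    elems    : Vec Carrier q
    complete : (x : Carrier) → Σ (Fin q) (λ i → x ≈ lookup elems i)
    distinct : (i j : Fin q) → lookup elems i ≈ lookup elems j → i ≡ j

module LinearCodes {c ℓ : Level} {q : ℕ} (F : FiniteField c ℓ q) where
  open FiniteField F using (Carrier; _≈_; _+_; _*_; 0#)

  Vector : ℕ → Set c
  Vector n = Fin n → Carrier

  ∑ : (m : ℕ) → (Fin m → Carrier) → Carrier
  ∑ ℕ.zero    f = 0#
  ∑ (ℕ.suc m) f = f Fin.zero + ∑ m (λ i → f (Fin.suc i))

  comb : {m n : ℕ} → (Fin m → Carrier) → (Fin m → Vector n) → Vector n
  comb {m} a v j = ∑ m (λ i → a i * v i j)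

  _≈ᵥ_ : {n : ℕ} → Vector n → Vector n → Set ℓ
  x ≈ᵥ y = ∀ j → x j ≈ y j

  InSpan : {m n : ℕ} → (Fin m → Vector n) → Vector n → Set (c ⊔ ℓ)
  InSpan {m} v x = Σ (Fin m → Carrier) (λ a → x ≈ᵥ comb a v)

  LinIndep : {m n : ℕ} → (Fin m → Vector n) → Set (c ⊔ ℓ)
  LinIndep {m} {n} v = (a : Fin m → Carrier) → comb a v ≈ᵥ (λ _ → 0#) → ∀ i → a i ≈ 0#

  -- An [n,m]-linear code, given by a generator matrix (m linearly independent rows);
  -- the code itself is the row space.
  record Code (n m : ℕ) : Set (c ⊔ ℓ) where
    field
      gen   : Fin m → Vector n
      indep : LinIndep gen
  open Code public

  _∈C_ : {n m : ℕ} → Vector n → Code n m → Set (c ⊔ ℓ)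
  x ∈C X = InSpan (gen X) x

  _⊆C_ : {n m m' : ℕ} → Code n m → Code n m' → Set (c ⊔ ℓ)
  X ⊆C Y = ∀ x → x ∈C X → x ∈C Y

  SameCode : {n m : ℕ} → Code n m → Code n m → Set (c ⊔ ℓ)
  SameCode X Y = (X ⊆C Y) × (Y ⊆C X)

  Injective : {a b : ℕ} → (Fin a → Fin b) → Set
  Injective s = ∀ i j → s i ≡ s j → i ≡ j

  TColIndep : {n m : ℕ} → ℕ → (Fin m → Vector n) → Set (c ⊔ ℓ)
  TColIndep {n} {m} t g =
    (s : Fin t → Fin n) → Injective s → LinIndep (λ a i → g i (s a))

  InCt : {n m : ℕ} → ℕ → Code n m → Set (c ⊔ ℓ)
  InCt t X = TColIndep t (gen X)

  IsIntersection : {n m d : ℕ} → Code n m → Code n m → Code n d → Set (c ⊔ ℓ)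
  IsIntersection X Y D = (D ⊆C X) × (D ⊆C Y) × (∀ x → x ∈C X → x ∈C Y → x ∈C D)

  CtCode : ℕ → ℕ → ℕ → Set (c ⊔ ℓ)
  CtCode t n m = Σ (Code n m) (InCt t)

  -- adjacency in Δ_t(n,m): dim (X ∩ Y) = m - 1
  AdjΔ : {t n m : ℕ} → CtCode t n m → CtCode t n m → Set (c ⊔ ℓ)
  AdjΔ {t} {n} {m} (X , _) (Y , _) =
    Σ (Code n (m ∸ 1)) (λ D → IsIntersection X Y D)

  -- adjacency in Λ_t(n,k): X ∩ Y ∈ 𝒞_t(n,k-1)
  AdjΛ : {t n k : ℕ} → CtCode t n k → CtCode t n k → Set (c ⊔ ℓ)
  AdjΛ {t} {n} {k} (X , _) (Y , _) =
    Σ (Code n (k ∸ 1)) (λ D → IsIntersection X Y D × InCt t D)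

  -- same connected component: reflexive-transitive closure of adjacency,
  -- where two generator matrices of the same code count as the same vertex
  SameCompΔ : {t n m : ℕ} → CtCode t n m → CtCode t n m → Set (c ⊔ ℓ)
  SameCompΔ = Star (λ X Y → SameCode (Data.Product.proj₁ X) (Data.Product.proj₁ Y) ⊎ AdjΔ X Y)

  SameCompΛ : {t n k : ℕ} → CtCode t n k → CtCode t n k → Set (c ⊔ ℓ)
  SameCompΛ = Star (λ X Y → SameCode (Data.Product.proj₁ X) (Data.Product.proj₁ Y) ⊎ AdjΛ X Y)

  Isolated : {t n k : ℕ} → CtCode t n k → Set (c ⊔ ℓ)
  Isolated {t} {n} {k} (C , _) =
    ¬ Σ (Code n (k ∸ 1)) (λ D → (D ⊆C C) × InCt t D)

{-# OPTIONS --safe #-}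
-- Walk along the Δ-path D = D₀, D₁, …, Dᵣ = D', carrying a code E in the Λ-component of C
-- with Dᵢ ⊆ E. Across a Δ-edge Dᵢ ~ Dᵢ₊₁ either Dᵢ₊₁ ⊆ Dᵢ (so they are the same code), or
-- Dᵢ + Dᵢ₊₁ is a k-dimensional code E'; it lies in 𝒞_t because any code containing a member
-- of 𝒞_t does. Two k-codes containing a common (k-1)-code of 𝒞_t either coincide or meet
-- exactly in it, so they are equal or Λ-adjacent; this moves E to E', and at the end joins
-- E to C' through D'. The dimension counts rest on the fact that k independent vectors in
-- the span of k vectors span it (Gaussian elimination), and every case distinction is
-- decidable because the field is finite.
module Submission where

open import Defs
open import Level using (Level; _⊔_)
open import Data.Nat using (ℕ; _<_; _≤_; _∸_; zero; suc)
open import Data.Fin using (Fin; zero; suc)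
open import Data.Fin.Properties using (any?; all?)
open import Data.Fin.Permutation using (Permutation′; _⟨$⟩ʳ_; _⟨$⟩ˡ_; inverseˡ; transpose)
open import Data.Vec using (lookup)
open import Data.Vec.Functional using (_∷_)
open import Data.Product using (Σ; _×_; _,_; proj₁; proj₂)
open import Data.Sum using (_⊎_; inj₁; inj₂)
open import Data.Empty using (⊥-elim)
open import Function using (_∘_)
open import Relation.Nullary using (¬_; Dec; yes; no)
open import Relation.Nullary.Decidable using (¬?; decidable-stable)
import Relation.Binary.PropositionalEquality as ≡
open import Relation.Binary.Construct.Closure.ReflexiveTransitive using (ε; _◅_; _◅◅_)

module _ {c ℓ : Level} {q : ℕ} (F : FiniteField c ℓ q) where
  open FiniteField F hiding (zero)
  open LinearCodes F
  open import Relation.Binary.Reasoning.Setoid setoid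
  open import Algebra.Properties.Ring ring using (-‿distribˡ-*; -‿distribʳ-*; x[y-z]≈xy-xz)
  open import Algebra.Properties.Group +-group using (inverseˡ-unique)
  open import Algebra.Properties.CommutativeSemigroup +-commutativeSemigroup
    using () renaming (interchange to +-interchange)
  open import Algebra.Properties.CommutativeSemigroup *-commutativeSemigroup
    using () renaming (x∙yz≈y∙xz to *-leftSwap)
  open import Algebra.Properties.CommutativeMonoid.Sum +-commutativeMonoid using (sum; sum-permute)

  ∑-cong : ∀ m {f g : Fin m → Carrier} → (∀ i → f i ≈ g i) → ∑ m f ≈ ∑ m g
  ∑-cong zero    f≈g = refl
  ∑-cong (suc m) f≈g = +-cong (f≈g zero) (∑-cong m (f≈g ∘ suc))

  ∑-zero : ∀ m {f : Fin m → Carrier} → (∀ i → f i ≈ 0#) → ∑ m f ≈ 0#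
  ∑-zero zero    f≈0 = refl
  ∑-zero (suc m) f≈0 = trans (+-cong (f≈0 zero) (∑-zero m (f≈0 ∘ suc))) (+-identityˡ 0#)

  ∑-distrib-+ : ∀ m (f g : Fin m → Carrier) → ∑ m (λ i → f i + g i) ≈ ∑ m f + ∑ m g
  ∑-distrib-+ zero    f g = sym (+-identityˡ 0#)
  ∑-distrib-+ (suc m) f g =
    trans (+-congˡ (∑-distrib-+ m (f ∘ suc) (g ∘ suc))) (+-interchange (f zero) (g zero) _ _)

  *-distribˡ-∑ : ∀ m x (f : Fin m → Carrier) → x * ∑ m f ≈ ∑ m (λ i → x * f i)
  *-distribˡ-∑ zero    x f = zeroʳ x
  *-distribˡ-∑ (suc m) x f = trans (distribˡ x _ _) (+-congˡ (*-distribˡ-∑ m x (f ∘ suc)))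

  *-distribʳ-∑ : ∀ m x (f : Fin m → Carrier) → ∑ m f * x ≈ ∑ m (λ i → f i * x)
  *-distribʳ-∑ m x f =
    trans (*-comm _ x) (trans (*-distribˡ-∑ m x f) (∑-cong m (λ i → *-comm x (f i))))

  ∑-comm : ∀ m p (f : Fin m → Fin p → Carrier) →
           ∑ m (λ i → ∑ p (f i)) ≈ ∑ p (λ k → ∑ m (λ i → f i k))
  ∑-comm zero    p f = sym (∑-zero p (λ _ → refl))
  ∑-comm (suc m) p f =
    trans (+-congˡ (∑-comm m p (f ∘ suc))) (sym (∑-distrib-+ p (f zero) (λ k → ∑ m (λ i → f (suc i) k))))

  ∑≡sum : ∀ m (f : Fin m → Carrier) → ∑ m f ≡.≡ sum f
  ∑≡sum zero    f = ≡.refl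
  ∑≡sum (suc m) f = ≡.cong (f zero +_) (∑≡sum m (f ∘ suc))

  ∑-permute : ∀ {m} (f : Fin m → Carrier) (π : Permutation′ m) → ∑ m f ≈ ∑ m (f ∘ (π ⟨$⟩ʳ_))
  ∑-permute {m} f π = begin
    ∑ m f                 ≡⟨ ∑≡sum m f ⟩
    sum f                 ≈⟨ sum-permute f π ⟩
    sum (f ∘ (π ⟨$⟩ʳ_))   ≡⟨ ≡.sym (∑≡sum m _) ⟩
    ∑ m (f ∘ (π ⟨$⟩ʳ_))   ∎

  δ : ∀ {m} → Fin m → Fin m → Carrier
  δ zero    zero    = 1#
  δ zero    (suc i) = 0#
  δ (suc j) zero    = 0#
  δ (suc j) (suc i) = δ j i

  ∑-δ : ∀ m (j : Fin m) (f : Fin m → Carrier) → ∑ m (λ i → δ j i * f i) ≈ f j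
  ∑-δ (suc m) zero f =
    trans (+-cong (*-identityˡ (f zero)) (∑-zero m (λ i → zeroˡ (f (suc i))))) (+-identityʳ (f zero))
  ∑-δ (suc m) (suc j) f =
    trans (+-congʳ (zeroˡ (f zero))) (trans (+-identityˡ _) (∑-δ m j (f ∘ suc)))

  comb-congˡ : ∀ {m n} {a b : Fin m → Carrier} (v : Fin m → Vector n) →
               (∀ i → a i ≈ b i) → comb a v ≈ᵥ comb b v
  comb-congˡ {m} v a≈b j = ∑-cong m (λ i → *-congʳ (a≈b i))

  comb-congʳ : ∀ {m n} (a : Fin m → Carrier) {u v : Fin m → Vector n} →
               (∀ i → u i ≈ᵥ v i) → comb a u ≈ᵥ comb a v
  comb-congʳ {m} a u≈v j = ∑-cong m (λ i → *-congˡ (u≈v i j))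

  comb-zero : ∀ {m n} {a : Fin m → Carrier} (v : Fin m → Vector n) →
              (∀ i → a i ≈ 0#) → comb a v ≈ᵥ (λ _ → 0#)
  comb-zero {m} v a≈0 j = ∑-zero m (λ i → trans (*-congʳ (a≈0 i)) (zeroˡ (v i j)))

  comb-scale : ∀ {m n} x (a : Fin m → Carrier) (v : Fin m → Vector n) →
               comb (λ i → x * a i) v ≈ᵥ (λ j → x * comb a v j)
  comb-scale {m} x a v j = begin
    ∑ m (λ i → (x * a i) * v i j)   ≈⟨ ∑-cong m (λ i → *-assoc x (a i) (v i j)) ⟩
    ∑ m (λ i → x * (a i * v i j))   ≈⟨ *-distribˡ-∑ m x _ ⟨
    x * comb a v j                  ∎

  comb-comb : ∀ {m p n} (a : Fin m → Carrier) (b : Fin m → Fin p → Carrier) (w : Fin p → Vector n) →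
              comb a (λ i → comb (b i) w) ≈ᵥ comb (comb a b) w
  comb-comb {m} {p} a b w j = begin
    ∑ m (λ i → a i * ∑ p (λ k → b i k * w k j))     ≈⟨ ∑-cong m (λ i → *-distribˡ-∑ p (a i) _) ⟩
    ∑ m (λ i → ∑ p (λ k → a i * (b i k * w k j)))   ≈⟨ ∑-comm m p _ ⟩
    ∑ p (λ k → ∑ m (λ i → a i * (b i k * w k j)))   ≈⟨ ∑-cong p (λ k → ∑-cong m (λ i → sym (*-assoc _ _ _))) ⟩
    ∑ p (λ k → ∑ m (λ i → (a i * b i k) * w k j))   ≈⟨ ∑-cong p (λ k → *-distribʳ-∑ m (w k j) _) ⟨
    ∑ p (λ k → comb a b k * w k j)                   ∎

  ∑-*-comb : ∀ {m} t (b : Fin t → Carrier) (a : Fin m → Carrier) (w : Fin m → Vector t) →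
             ∑ t (λ k → b k * comb a w k) ≈ ∑ m (λ i → a i * ∑ t (λ k → b k * w i k))
  ∑-*-comb {m} t b a w = begin
    ∑ t (λ k → b k * ∑ m (λ i → a i * w i k))     ≈⟨ ∑-cong t (λ k → *-distribˡ-∑ m (b k) _) ⟩
    ∑ t (λ k → ∑ m (λ i → b k * (a i * w i k)))   ≈⟨ ∑-comm t m _ ⟩
    ∑ m (λ i → ∑ t (λ k → b k * (a i * w i k)))   ≈⟨ ∑-cong m (λ i → ∑-cong t (λ k → *-leftSwap _ _ _)) ⟩
    ∑ m (λ i → ∑ t (λ k → a i * (b k * w i k)))   ≈⟨ ∑-cong m (λ i → *-distribˡ-∑ t (a i) _) ⟨
    ∑ m (λ i → a i * ∑ t (λ k → b k * w i k))     ∎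

  LinDep : ∀ {m n} → (Fin m → Vector n) → Set (c ⊔ ℓ)
  LinDep {m} v = Σ (Fin m → Carrier) λ a → (comb a v ≈ᵥ (λ _ → 0#)) × Σ (Fin m) λ i → ¬ a i ≈ 0#

  LinIndep⇒¬LinDep : ∀ {m n} {v : Fin m → Vector n} → LinIndep v → ¬ LinDep v
  LinIndep⇒¬LinDep indep (a , a·v≈0 , i , aᵢ≉0) = aᵢ≉0 (indep a a·v≈0 i)

  LinDep-∘suc : ∀ {m n} {v : Fin (suc m) → Vector n} → LinDep (v ∘ suc) → LinDep v
  LinDep-∘suc {v = v} (a , a·v≈0 , i , aᵢ≉0) =
    (0# ∷ a) , (λ j → trans (+-congʳ (zeroˡ (v zero j))) (trans (+-identityˡ _) (a·v≈0 j))) , suc i , aᵢ≉0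

  LinDep-tails : ∀ {m n} {v : Fin m → Vector (suc n)} →
                 (∀ i → v i zero ≈ 0#) → LinDep (λ i → v i ∘ suc) → LinDep v
  LinDep-tails {m} {v = v} head≈0 (a , a·v≈0 , nontrivial) = a , a·v≈0′ , nontrivial
    where
    a·v≈0′ : comb a v ≈ᵥ (λ _ → 0#)
    a·v≈0′ zero    = ∑-zero m (λ i → trans (*-congˡ (head≈0 i)) (zeroʳ (a i)))
    a·v≈0′ (suc j) = a·v≈0 j

  LinDep-eliminate : ∀ {m n} (v : Fin (suc m) → Vector n) (μ : Fin m → Carrier) →
                     LinDep (λ i j → v (suc i) j - μ i * v zero j) → LinDep v
  LinDep-eliminate {m} v μ (b , b·w≈0 , i , bᵢ≉0) =
    (x ∷ b) , (λ j → trans (elimination j) (b·w≈0 j)) , suc i , bᵢ≉0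
    where
    x = ∑ m (λ i → - (b i * μ i))
    elimination : ∀ j → x * v zero j + comb b (v ∘ suc) j ≈ comb b (λ i j → v (suc i) j - μ i * v zero j) j
    elimination j = begin
      x * v zero j + comb b (v ∘ suc) j
        ≈⟨ +-comm _ _ ⟩
      comb b (v ∘ suc) j + x * v zero j
        ≈⟨ +-congˡ (*-distribʳ-∑ m (v zero j) _) ⟩
      comb b (v ∘ suc) j + ∑ m (λ i → - (b i * μ i) * v zero j)
        ≈⟨ ∑-distrib-+ m _ _ ⟨
      ∑ m (λ i → b i * v (suc i) j + - (b i * μ i) * v zero j)
        ≈⟨ ∑-cong m (λ i → +-congˡ (begin
             - (b i * μ i) * v zero j   ≈⟨ -‿distribˡ-* _ _ ⟨
             - ((b i * μ i) * v zero j) ≈⟨ -‿cong (*-assoc _ _ _) ⟩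
             - (b i * (μ i * v zero j)) ∎)) ⟩
      ∑ m (λ i → b i * v (suc i) j - b i * (μ i * v zero j))
        ≈⟨ ∑-cong m (λ i → x[y-z]≈xy-xz (b i) _ _) ⟨
      comb b (λ i j → v (suc i) j - μ i * v zero j) j ∎

  LinDep-permute : ∀ {m n} (π : Permutation′ m) {v : Fin m → Vector n} →
                   LinDep (v ∘ (π ⟨$⟩ʳ_)) → LinDep v
  LinDep-permute {m} π {v} (b , b·vπ≈0 , i , bᵢ≉0) =
    b ∘ (π ⟨$⟩ˡ_) , a·v≈0 , π ⟨$⟩ʳ i , ≡.subst (λ y → ¬ b y ≈ 0#) (≡.sym (inverseˡ π)) bᵢ≉0
    where
    a·v≈0 : comb (b ∘ (π ⟨$⟩ˡ_)) v ≈ᵥ (λ _ → 0#)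
    a·v≈0 j = begin
      ∑ m (λ i → b (π ⟨$⟩ˡ i) * v i j)
        ≈⟨ ∑-permute _ π ⟩
      ∑ m (λ i → b (π ⟨$⟩ˡ (π ⟨$⟩ʳ i)) * v (π ⟨$⟩ʳ i) j)
        ≈⟨ ∑-cong m (λ i → reflexive (≡.cong (λ k → b k * v (π ⟨$⟩ʳ i) j) (inverseˡ π))) ⟩
      comb b (v ∘ (π ⟨$⟩ʳ_)) j
        ≈⟨ b·vπ≈0 j ⟩
      0# ∎

  -- Gaussian elimination on the first coordinate: either that column vanishes, or a pivot
  -- vector is swapped to the front and subtracted from the others to clear it.
  LinDep-tooManyVectors : ∀ m (v : Fin (suc m) → Vector m) → LinDep v
  LinDep-tooManyVectors zero    v = (λ _ → 1#) , (λ ()) , zero , λ 1≈0 → 0≉1 (sym 1≈0)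
  LinDep-tooManyVectors (suc m) v with any? (λ i → ¬? (v i zero ≟ 0#))
  ... | no noPivot =
    LinDep-∘suc {v = v}
      (LinDep-tails {v = v ∘ suc} column≈0 (LinDep-tooManyVectors m (λ i → v (suc i) ∘ suc)))
    where
    column≈0 : ∀ i → v (suc i) zero ≈ 0#
    column≈0 i = decidable-stable (v (suc i) zero ≟ 0#) (λ ≉0 → noPivot (suc i , ≉0))
  ... | yes (p , pivot≉0) =
    LinDep-permute τ {v} (LinDep-eliminate (v ∘ (τ ⟨$⟩ʳ_)) μ
      (LinDep-tails {v = w} cleared (LinDep-tooManyVectors m (λ i → w i ∘ suc))))
    where
    τ = transpose zero p
    r = proj₁ (inverse (v p zero) pivot≉0)
    p·r≈1 = proj₂ (inverse (v p zero) pivot≉0)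
    μ : Fin (suc m) → Carrier
    μ i = v (τ ⟨$⟩ʳ suc i) zero * r
    w : Fin (suc m) → Vector (suc m)
    w i j = v (τ ⟨$⟩ʳ suc i) j - μ i * v p j
    cleared : ∀ i → v (τ ⟨$⟩ʳ suc i) zero - μ i * v p zero ≈ 0#
    cleared i = let y = v (τ ⟨$⟩ʳ suc i) zero in begin
      y - (y * r) * v p zero    ≈⟨ +-congˡ (-‿cong (*-assoc y r (v p zero))) ⟩
      y - y * (r * v p zero)    ≈⟨ +-congˡ (-‿cong (*-congˡ (trans (*-comm r _) p·r≈1))) ⟩
      y - y * 1#                ≈⟨ +-congˡ (-‿cong (*-identityʳ y)) ⟩
      y - y                     ≈⟨ -‿inverseʳ y ⟩
      0#                        ∎

  ∃-coefficients? : ∀ {p} m (Q : (Fin m → Carrier) → Set p) →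
                    (∀ {a b} → (∀ i → a i ≈ b i) → Q a → Q b) → (∀ a → Dec (Q a)) →
                    Dec (Σ (Fin m → Carrier) Q)
  ∃-coefficients? zero Q resp Q? with Q? (λ ())
  ... | yes q = yes ((λ ()) , q)
  ... | no ¬q = no λ (a , qa) → ¬q (resp (λ ()) qa)
  ∃-coefficients? (suc m) Q resp Q? with any? (λ k → ∃-coefficients? m (Q ∘ (lookup elems k ∷_))
        (λ a≈b → resp λ { zero → refl ; (suc i) → a≈b i }) (Q? ∘ (lookup elems k ∷_)))
  ... | yes (k , a , qa) = yes (_ , qa)
  ... | no ¬q = no λ (a , qa) → let (k , a₀≈k) = complete (a zero) in
    ¬q (k , a ∘ suc , resp (λ { zero → a₀≈k ; (suc i) → refl }) qa)

  InSpan? : ∀ {m n} (v : Fin m → Vector n) (x : Vector n) → Dec (InSpan v x)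
  InSpan? {m} v x = ∃-coefficients? m (λ a → x ≈ᵥ comb a v)
    (λ a≈b x≈av j → trans (x≈av j) (comb-congˡ v a≈b j)) (λ a → all? (λ j → x j ≟ comb a v j))

  InSpan-resp : ∀ {m n} (v : Fin m → Vector n) {x y : Vector n} → x ≈ᵥ y → InSpan v y → InSpan v x
  InSpan-resp v x≈y (a , y≈av) = a , λ j → trans (x≈y j) (y≈av j)

  InSpan-gen : ∀ {m n} (v : Fin m → Vector n) (i : Fin m) → InSpan v (v i)
  InSpan-gen {m} v i = δ i , λ j → sym (∑-δ m i (λ k → v k j))

  InSpan-∷ : ∀ {m p n} (w : Fin m → Vector n) {z : Vector n} {u : Fin p → Vector n} →
             InSpan w z → (∀ i → InSpan w (u i)) → ∀ i → InSpan w ((z ∷ u) i)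
  InSpan-∷ w z∈w u⊆w zero    = z∈w
  InSpan-∷ w z∈w u⊆w (suc i) = u⊆w i

  InSpan-comb : ∀ {m p n} {u : Fin p → Vector n} {w : Fin m → Vector n} →
                (∀ i → InSpan w (u i)) → ∀ a → InSpan w (comb a u)
  InSpan-comb {w = w} u⊆w a =
    comb a (proj₁ ∘ u⊆w) , λ j → trans (comb-congʳ a (proj₂ ∘ u⊆w) j) (comb-comb a (proj₁ ∘ u⊆w) w j)

  _⊆ₛ_ : ∀ {p m n} → (Fin p → Vector n) → (Fin m → Vector n) → Set (c ⊔ ℓ)
  u ⊆ₛ w = ∀ x → InSpan u x → InSpan w x

  gens⇒⊆ₛ : ∀ {p m n} (u : Fin p → Vector n) (w : Fin m → Vector n) → (∀ i → InSpan w (u i)) → u ⊆ₛ w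
  gens⇒⊆ₛ u w u⊆w x (a , x≈au) = InSpan-resp w x≈au (InSpan-comb u⊆w a)

  ⊆ₛ⇒gens : ∀ {p m n} (u : Fin p → Vector n) (w : Fin m → Vector n) → u ⊆ₛ w → ∀ i → InSpan w (u i)
  ⊆ₛ⇒gens u w u⊆w i = u⊆w (u i) (InSpan-gen u i)

  LinDep-inSpan : ∀ {m n} (w : Fin m → Vector n) {u : Fin (suc m) → Vector n} →
                  (∀ i → InSpan w (u i)) → LinDep u
  LinDep-inSpan {m} w {u} u⊆w with LinDep-tooManyVectors m (proj₁ ∘ u⊆w)
  ... | a , a·coeffs≈0 , nontrivial = a , a·u≈0 , nontrivial
    where
    a·u≈0 : comb a u ≈ᵥ (λ _ → 0#)
    a·u≈0 j = begin
      comb a u j                                ≈⟨ comb-congʳ a (proj₂ ∘ u⊆w) j ⟩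
      comb a (λ i → comb (proj₁ (u⊆w i)) w) j   ≈⟨ comb-comb a (proj₁ ∘ u⊆w) w j ⟩
      comb (comb a (proj₁ ∘ u⊆w)) w j           ≈⟨ comb-zero w a·coeffs≈0 j ⟩
      0#                                        ∎

  InSpan-isolate : ∀ {m n} {u : Fin m → Vector n} {z : Vector n} (a : Fin (suc m) → Carrier) →
                   ¬ a zero ≈ 0# → comb a (z ∷ u) ≈ᵥ (λ _ → 0#) → InSpan u z
  InSpan-isolate {u = u} {z} a a₀≉0 a·zu≈0 = (λ i → - r * a (suc i)) , λ j → begin
    z j                          ≈⟨ *-identityˡ (z j) ⟨
    1# * z j                     ≈⟨ *-congʳ (trans (*-comm r (a zero)) a₀r≈1) ⟨
    r * a zero * z j             ≈⟨ *-assoc r (a zero) (z j) ⟩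
    r * (a zero * z j)           ≈⟨ *-congˡ (inverseˡ-unique _ _ (a·zu≈0 j)) ⟩
    r * - comb (a ∘ suc) u j     ≈⟨ -‿distribʳ-* r _ ⟨
    - (r * comb (a ∘ suc) u j)   ≈⟨ -‿distribˡ-* r _ ⟩
    - r * comb (a ∘ suc) u j     ≈⟨ comb-scale (- r) (a ∘ suc) u j ⟨
    comb (λ i → - r * a (suc i)) u j ∎
    where
    r = proj₁ (inverse (a zero) a₀≉0)
    a₀r≈1 = proj₂ (inverse (a zero) a₀≉0)

  LinIndep-∷ : ∀ {m n} (u : Fin m → Vector n) {z : Vector n} →
               LinIndep u → ¬ InSpan u z → LinIndep (z ∷ u)
  LinIndep-∷ u {z} u-indep z∉u a a·zu≈0 with a zero ≟ 0#
  ... | no a₀≉0 = ⊥-elim (z∉u (InSpan-isolate a a₀≉0 a·zu≈0))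
  ... | yes a₀≈0 = λ { zero → a₀≈0 ; (suc i) → u-indep (a ∘ suc) tail≈0 i }
    where
    tail≈0 : comb (a ∘ suc) u ≈ᵥ (λ _ → 0#)
    tail≈0 j = begin
      comb (a ∘ suc) u j                  ≈⟨ +-identityˡ _ ⟨
      0# + comb (a ∘ suc) u j             ≈⟨ +-congʳ (trans (*-congʳ a₀≈0) (zeroˡ (z j))) ⟨
      a zero * z j + comb (a ∘ suc) u j   ≈⟨ a·zu≈0 j ⟩
      0#                                  ∎

  LinIndep-spans : ∀ {m n} (u w : Fin m → Vector n) → LinIndep u → (∀ i → InSpan w (u i)) → w ⊆ₛ u
  LinIndep-spans u w u-indep u⊆w z z∈w with InSpan? u z
  ... | yes z∈u = z∈u
  ... | no z∉u =
    ⊥-elim (LinIndep⇒¬LinDep {v = z ∷ u} (LinIndep-∷ u u-indep z∉u) (LinDep-inSpan w (InSpan-∷ w z∈w u⊆w)))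

  SameCode-commonBasis : ∀ {m n} (X Y : Code n m) (u : Fin m → Vector n) → LinIndep u →
                         (∀ i → u i ∈C X) → (∀ i → u i ∈C Y) → SameCode X Y
  SameCode-commonBasis X Y u u-indep u⊆X u⊆Y =
    (λ x → gens⇒⊆ₛ u (gen Y) u⊆Y x ∘ LinIndep-spans u (gen X) u-indep u⊆X x) ,
    (λ x → gens⇒⊆ₛ u (gen X) u⊆X x ∘ LinIndep-spans u (gen Y) u-indep u⊆Y x)

  SameCode⊎IsIntersection : ∀ {m n} (X Y : Code n (suc m)) (D : Code n m) → D ⊆C X → D ⊆C Y →
                            SameCode X Y ⊎ IsIntersection X Y D
  SameCode⊎IsIntersection X Y D D⊆X D⊆Y with any? (λ i → ¬? (InSpan? (gen Y) (gen X i)))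
  ... | no none = inj₁ (SameCode-commonBasis X Y (gen X) (indep X) (InSpan-gen (gen X)) X⊆Y)
    where
    X⊆Y : ∀ i → gen X i ∈C Y
    X⊆Y i = decidable-stable (InSpan? (gen Y) (gen X i)) (none ∘ (i ,_))
  ... | yes (i , Xᵢ∉Y) = inj₂ (D⊆X , D⊆Y , X∩Y⊆D)
    where
    X∩Y⊆D : ∀ z → z ∈C X → z ∈C Y → z ∈C D
    X∩Y⊆D z z∈X z∈Y = decidable-stable (InSpan? (gen D) z) λ z∉D →
      let X≡Y = SameCode-commonBasis X Y (z ∷ gen D) (LinIndep-∷ (gen D) (indep D) z∉D)
                  (InSpan-∷ (gen X) z∈X (⊆ₛ⇒gens (gen D) (gen X) D⊆X))
                  (InSpan-∷ (gen Y) z∈Y (⊆ₛ⇒gens (gen D) (gen Y) D⊆Y))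
      in Xᵢ∉Y (⊆ₛ⇒gens (gen X) (gen Y) (proj₁ X≡Y) i)

  ⊆⊎commonSupercode : ∀ {m n} (D₁ D₂ : Code n m) (G : Code n (m ∸ 1)) → G ⊆C D₁ → G ⊆C D₂ →
                      D₂ ⊆C D₁ ⊎ Σ (Code n (suc m)) λ E → D₁ ⊆C E × D₂ ⊆C E
  ⊆⊎commonSupercode {zero}  D₁ D₂ G G⊆D₁ G⊆D₂ = inj₁ (gens⇒⊆ₛ (gen D₂) (gen D₁) λ ())
  ⊆⊎commonSupercode {suc m} D₁ D₂ G G⊆D₁ G⊆D₂ with any? (λ j → ¬? (InSpan? (gen D₁) (gen D₂ j)))
  ... | no none =
    inj₁ (gens⇒⊆ₛ (gen D₂) (gen D₁) λ j → decidable-stable (InSpan? (gen D₁) (gen D₂ j)) (none ∘ (j ,_)))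
  ... | yes (j , y∉D₁) = inj₂ (E , D₁⊆E , D₂⊆E)
    where
    y = gen D₂ j
    E : Code _ (suc (suc m))
    E = record { gen = y ∷ gen D₁ ; indep = LinIndep-∷ (gen D₁) (indep D₁) y∉D₁ }
    D₁⊆E : D₁ ⊆C E
    D₁⊆E = gens⇒⊆ₛ (gen D₁) (gen E) (InSpan-gen (gen E) ∘ suc)
    yG-indep : LinIndep (y ∷ gen G)
    yG-indep = LinIndep-∷ (gen G) (indep G) (y∉D₁ ∘ G⊆D₁ y)
    D₂⊆yG : gen D₂ ⊆ₛ (y ∷ gen G)
    D₂⊆yG = LinIndep-spans (y ∷ gen G) (gen D₂) yG-indep
              (InSpan-∷ (gen D₂) (InSpan-gen (gen D₂) j) (⊆ₛ⇒gens (gen G) (gen D₂) G⊆D₂))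
    yG⊆E : (y ∷ gen G) ⊆ₛ gen E
    yG⊆E = gens⇒⊆ₛ (y ∷ gen G) (gen E)
             (InSpan-∷ (gen E) (InSpan-gen (gen E) zero) (λ i → D₁⊆E _ (⊆ₛ⇒gens (gen G) (gen D₁) G⊆D₁ i)))
    D₂⊆E : D₂ ⊆C E
    D₂⊆E x = yG⊆E x ∘ D₂⊆yG x

  InCt-⊆ : ∀ {t n m m'} (D : Code n m) (E : Code n m') → InCt t D → D ⊆C E → InCt t E
  InCt-⊆ {t} {m' = m'} D E D∈Ct D⊆E s s-inj b b·E≈0 = D∈Ct s s-inj b b·D≈0
    where
    b·D≈0 : ∀ i → ∑ t (λ k → b k * gen D i (s k)) ≈ 0#
    b·D≈0 i = let (a , Dᵢ≈aE) = ⊆ₛ⇒gens (gen D) (gen E) D⊆E i in begin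
      ∑ t (λ k → b k * gen D i (s k))                     ≈⟨ ∑-cong t (λ k → *-congˡ (Dᵢ≈aE (s k))) ⟩
      ∑ t (λ k → b k * comb a (gen E) (s k))              ≈⟨ ∑-*-comb t b a (λ i → gen E i ∘ s) ⟩
      ∑ m' (λ i → a i * ∑ t (λ k → b k * gen E i (s k)))
        ≈⟨ ∑-zero m' (λ i → trans (*-congˡ (b·E≈0 i)) (zeroʳ (a i))) ⟩
      0#                                                  ∎

  SameCompΛ-commonSubcode : ∀ {t n m} (E E' : CtCode t n (suc m)) (D : CtCode t n m) →
                            proj₁ D ⊆C proj₁ E → proj₁ D ⊆C proj₁ E' → SameCompΛ E E'
  SameCompΛ-commonSubcode E E' D D⊆E D⊆E'
    with SameCode⊎IsIntersection (proj₁ E) (proj₁ E') (proj₁ D) D⊆E D⊆E'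
  ... | inj₁ same = inj₁ same ◅ ε
  ... | inj₂ meet = inj₂ (proj₁ D , meet , proj₂ D) ◅ ε

  SameCompΛ-alongΔ : ∀ {t n m} (E C' : CtCode t n (suc m)) (D D' : CtCode t n m) →
                     proj₁ D ⊆C proj₁ E → SameCompΔ D D' → proj₁ D' ⊆C proj₁ C' → SameCompΛ E C'
  SameCompΛ-alongΔ E C' D D' D⊆E ε D'⊆C' = SameCompΛ-commonSubcode E C' D D⊆E D'⊆C'
  SameCompΛ-alongΔ E C' D D' D⊆E (_◅_ {j = D₂} (inj₁ (_ , D₂⊆D)) path) D'⊆C' =
    SameCompΛ-alongΔ E C' D₂ D' (λ x → D⊆E x ∘ D₂⊆D x) path D'⊆C'
  SameCompΛ-alongΔ {t} E C' D D' D⊆E (_◅_ {j = D₂} (inj₂ (G , G⊆D , G⊆D₂ , _)) path) D'⊆C'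
    with ⊆⊎commonSupercode (proj₁ D) (proj₁ D₂) G G⊆D G⊆D₂
  ... | inj₁ D₂⊆D = SameCompΛ-alongΔ E C' D₂ D' (λ x → D⊆E x ∘ D₂⊆D x) path D'⊆C'
  ... | inj₂ (E′ , D⊆E′ , D₂⊆E′) =
    SameCompΛ-commonSubcode E E″ D D⊆E D⊆E′ ◅◅ SameCompΛ-alongΔ E″ C' D₂ D' D₂⊆E′ path D'⊆C'
    where
    E″ : CtCode t _ _
    E″ = E′ , InCt-⊆ (proj₁ D) E′ (proj₂ D) D⊆E′

lemma3p4 : {c ℓ : Level} {q : ℕ} (F : FiniteField c ℓ q) →
    let open LinearCodes F in
    (n k t : ℕ) → 0 < k → k < n → t ≤ k →
    (C C' : CtCode t n k) → ¬ Isolated C → ¬ Isolated C' →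
    (D D' : CtCode t n (k ∸ 1)) →
    (proj₁ D ⊆C proj₁ C) → (proj₁ D' ⊆C proj₁ C') →
    SameCompΔ D D' →
    SameCompΛ C C'
lemma3p4 F n (suc m) t _ _ _ C C' _ _ D D' D⊆C D'⊆C' D~D' = SameCompΛ-alongΔ F C C' D D' D⊆C D~D' D'⊆C'
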